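{- Let $\mathscr W_0(x)=\sum_{T}W_T(t)x^{v(T)}/|\operatorname{Aut}T|$, summed over isomorphism classes of (unrooted) finite trees $T$, and let $\mathscr T(x)=\sum_{T}W_T(t)x^{v(T)}/|\operatorname{Aut}T|$ summed over isomorphism classes of rooted trees (with root-preserving automorphisms). Then $\mathscr W_0(x)=\int x^{ -1}\mathscr T(x)\,dx$ (the formal antiderivative with zero constant term).
   Context: A coloring of a tree $T$ is a map $c\colon V(T)\to\{0,1\}$ ($0$ white, $1$ black); a vertex is even-white if it is white with an even number of black neighbors; $W_T(t)=\sum_c t^{\#\{\text{even-white vertices}\}}$. $v(T)$ is the number of vertices of $T$. -}

module Defs where

open import Data.Nat as ℕ using (ℕ; zero; suc; _≤_)
open import Data.Bool using (Bool; true; false; not; _∧_; if_then_else_)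
open import Data.Fin using (Fin; zero; suc)
import Data.Fin as Fin
open import Data.List using (List; []; _∷_; map; concatMap; allFin; length; filterᵇ; foldr; _∷ʳ_; lookup)
open import Data.Bool.ListAction using (all; any)
open import Data.List.Relation.Unary.Unique.Propositional using (Unique)
open import Data.List.Relation.Unary.Linked using (Linked)
open import Data.List.Relation.Unary.Any using (Any)
open import Data.List.Relation.Unary.All using (All)
open import Data.Product using (Σ; _×_; ∃)
open import Data.Integer using (+_)
open import Data.Rational using (ℚ; 0ℚ; _/_; _+_; _*_)
open import Relation.Binary.PropositionalEquality using (_≡_)
open import Relation.Nullary using (¬_; does)

Graph : ℕ → Set
Graph n = Fin n → Fin n → Bool

Adj : ∀ {n} → Graph n → Fin n → Fin n → Set
Adj G u v = G u v ≡ true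

data Walk {n} (G : Graph n) : Fin n → Fin n → Set where
  here : ∀ {u} → Walk G u u
  step : ∀ {u w v} → Adj G u w → Walk G w v → Walk G u v

Cycle : ∀ {n} → Graph n → Set
Cycle {n} G = Σ (Fin n) λ x → Σ (List (Fin n)) λ xs →
  (2 ≤ length xs) × Unique (x ∷ xs) × Linked (Adj G) ((x ∷ xs) ∷ʳ x)

record IsTree {n : ℕ} (G : Graph n) : Set where
  field
    nonempty   : 1 ≤ n
    symmetric  : ∀ u v → G u v ≡ G v u
    irreflexive : ∀ v → G v v ≡ false
    connected  : ∀ u v → Walk G u v
    acyclic    : ¬ Cycle G

Iso : ∀ {n} → Graph n → Graph n → Set
Iso {n} G H = Σ (Fin n → Fin n) λ f → Σ (Fin n → Fin n) λ g →
  (∀ x → g (f x) ≡ x) × (∀ y → f (g y) ≡ y) × (∀ u v → H (f u) (f v) ≡ G u v)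

RootedIso : ∀ {n} → Graph n × Fin n → Graph n × Fin n → Set
RootedIso {n} (G Data.Product., r) (H Data.Product., s) =
  Σ (Fin n → Fin n) λ f → Σ (Fin n → Fin n) λ g →
  (∀ x → g (f x) ≡ x) × (∀ y → f (g y) ≡ y) × (∀ u v → H (f u) (f v) ≡ G u v)
  × (f r ≡ s)

-- L is a list containing exactly one representative of each isomorphism
-- class of trees with n vertices (vertex set Fin n).
TreeReps : (n : ℕ) → List (Graph n) → Set
TreeReps n L =
  All IsTree L ×
  (∀ (G : Graph n) → IsTree G → Any (Iso G) L) ×
  (∀ i j → Iso (lookup L i) (lookup L j) → i ≡ j)

RootedTreeReps : (n : ℕ) → List (Graph n × Fin n) → Set
RootedTreeReps n L =
  All (λ p → IsTree (Data.Product.proj₁ p)) L ×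
  (∀ (G : Graph n) (r : Fin n) → IsTree G → Any (RootedIso (G Data.Product., r)) L) ×
  (∀ i j → RootedIso (lookup L i) (lookup L j) → i ≡ j)

allFunsTo : ∀ {A : Set} → List A → (n : ℕ) → List (Fin n → A)
allFunsTo xs zero = (λ ()) ∷ []
allFunsTo xs (suc n) =
  concatMap (λ f → map (λ a → cons a f) xs) (allFunsTo xs n)
  where
    cons : _ → (Fin n → _) → Fin (suc n) → _
    cons a f zero = a
    cons a f (suc i) = f i

count : ∀ {A : Set} → (A → Bool) → List A → ℕ
count p xs = length (filterᵇ p xs)

_==ᶠ_ : ∀ {n} → Fin n → Fin n → Bool
x ==ᶠ y = does (x Fin.≟ y)

_==ᵇ_ : Bool → Bool → Bool
true ==ᵇ b = b
false ==ᵇ b = not b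

forall? : ∀ n → (Fin n → Bool) → Bool
forall? n p = all p (allFin n)

exists? : ∀ n → (Fin n → Bool) → Bool
exists? n p = any p (allFin n)

isBijectionᵇ : ∀ {n} → (Fin n → Fin n) → Bool
isBijectionᵇ {n} f =
  forall? n (λ u → forall? n (λ v → not (f u ==ᶠ f v) Data.Bool.∨ (u ==ᶠ v)))
  ∧ forall? n (λ y → exists? n (λ x → f x ==ᶠ y))

preservesᵇ : ∀ {n} → Graph n → (Fin n → Fin n) → Bool
preservesᵇ {n} G f = forall? n (λ u → forall? n (λ v → G (f u) (f v) ==ᵇ G u v))

autCount : ∀ {n} → Graph n → ℕ
autCount {n} G = count (λ f → isBijectionᵇ f ∧ preservesᵇ G f) (allFunsTo (allFin n) n)

rootedAutCount : ∀ {n} → Graph n × Fin n → ℕ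
rootedAutCount {n} (G Data.Product., r) =
  count (λ f → isBijectionᵇ f ∧ preservesᵇ G f ∧ (f r ==ᶠ r)) (allFunsTo (allFin n) n)

-- Colorings and even-white vertices (false = white, true = black)

Coloring : ℕ → Set
Coloring n = Fin n → Bool

evenᵇ : ℕ → Bool
evenᵇ zero = true
evenᵇ (suc m) = not (evenᵇ m)

blackNeighbours : ∀ {n} → Graph n → Coloring n → Fin n → ℕ
blackNeighbours {n} G c v = count (λ u → G v u ∧ c u) (allFin n)

isEvenWhite : ∀ {n} → Graph n → Coloring n → Fin n → Bool
isEvenWhite G c v = not (c v) ∧ evenᵇ (blackNeighbours G c v)

evenWhiteCount : ∀ {n} → Graph n → Coloring n → ℕ
evenWhiteCount {n} G c = count (isEvenWhite G c) (allFin n)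

-- coefficient of t^k in W_G(t)
Wcoeff : ∀ {n} → Graph n → ℕ → ℕ
Wcoeff {n} G k =
  count (λ c → does (evenWhiteCount G c ℕ.≟ k)) (allFunsTo (true ∷ false ∷ []) n)

-- Formal power series in x with coefficients in ℚ[t]:
-- S n k = coefficient of x^n t^k.

Series : Set
Series = ℕ → ℕ → ℚ

-- 1/m as a rational; only applied to m ≥ 1 (automorphism counts, n+1)
inv : ℕ → ℚ
inv zero = 0ℚ
inv (suc m) = + 1 / suc m

fromℕ : ℕ → ℚ
fromℕ m = + m / 1

sumℚ : List ℚ → ℚ
sumℚ = foldr _+_ 0ℚ

W₀ : (L : (n : ℕ) → List (Graph n)) → Series
W₀ L n k = sumℚ (map (λ G → fromℕ (Wcoeff G k) * inv (autCount G)) (L n))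

𝒯 : (R : (n : ℕ) → List (Graph n × Fin n)) → Series
𝒯 R n k = sumℚ (map (λ p → fromℕ (Wcoeff (Data.Product.proj₁ p) k) * inv (rootedAutCount p)) (R n))

-- x^{-1} F  (shift down; used for F with zero constant term)
divX : Series → Series
divX F m k = F (suc m) k

integral : Series → Series
integral G zero k = 0ℚ
integral G (suc m) k = G m k * inv (suc m)

{-# OPTIONS --safe #-}
module Submission where

-- Double counting.  For a tree G on Fin n, a root r and a rooted tree p, let N(G, r, p) be the
-- number of root-preserving isomorphisms (G, r) → p, and sum N · W_G / (|Aut G| · |Aut p|) over
-- the unrooted representatives G, the roots r and the rooted representatives p.  For fixed p only
-- the G isomorphic to the tree of p contributes, and summing N over r counts all isomorphisms
-- G → p, i.e. |Aut G| of them; this leaves W_p / |Aut p|, so the total is 𝒯_n.  For fixed (G, r)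
-- only the p isomorphic to (G, r) contributes, with N = |Aut p|; this leaves W_G / |Aut G| for each
-- of the n roots, so the total is n · 𝒲₀_n.  Hence 𝒲₀_n = 𝒯_n / n.

open import Algebra.Bundles using (CommutativeSemigroup)
open import Algebra.Core using (Op₂)
open import Algebra.Structures using (IsSemiring; IsRing)
open import Data.Bool using (Bool; true; false; not; _∧_; _∨_; T)
import Data.Bool as Bool
open import Data.Bool.Properties using (T-≡; T-∧; ∧-assoc)
open import Data.Empty using (⊥-elim)
open import Data.Fin using (Fin; zero; suc)
import Data.Fin as Fin
open import Data.Fin.Permutation as Perm using (Permutation; _⟨$⟩ʳ_; _⟨$⟩ˡ_)
open import Data.Fin.Properties using (suc-injective)
import Data.Integer as ℤ
import Data.Integer.Properties as ℤP
open import Data.List using (List; []; _∷_; map; concatMap; foldr; lookup; _++_; length; allFin; tabulate)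
open import Data.List.Membership.Propositional using (_∈_)
open import Data.List.Membership.Propositional.Properties using (∈-allFin)
open import Data.List.Properties using (filter-none; filter-some; map-tabulate; length-tabulate)
open import Data.List.Relation.Unary.All as All using (All; []; _∷_)
open import Data.List.Relation.Unary.All.Properties using (all⁺; all⁻)
open import Data.List.Relation.Unary.Any as Any using (Any; here; there; index)
open import Data.List.Relation.Unary.Any.Properties using (any⁺; any⁻; lookup-index)
import Data.Nat as ℕ
open import Data.Nat using (ℕ; zero; suc; NonZero; >-nonZero)
import Data.Nat.Coprimality as Coprime
import Data.Nat.Properties as ℕP
open import Data.Product using (Σ; ∃; _,_; _×_; proj₁; proj₂)
open import Data.Product.Function.NonDependent.Propositional using (_×-⇔_)
import Data.Rational as ℚ
open import Data.Rational using (ℚ; mkℚ; 0ℚ; 1ℚ)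
import Data.Rational.Properties as ℚP
import Data.Vec.Functional.Relation.Binary.Pointwise.Properties as Pointwise
open import Function using (_∘_; id)
open import Function.Bundles using (_⇔_; mk⇔; Equivalence; Inverse)
open import Function.Construct.Composition using (_⇔-∘_)
open import Function.Construct.Symmetry using (⇔-sym)
open import Level using (0ℓ)
open import Relation.Binary.Bundles using (Setoid; DecSetoid)
open import Relation.Binary.Core using (Rel)
open import Relation.Binary.Definitions using (_Respects_)
open import Relation.Binary.PropositionalEquality
  using (_≡_; _≢_; _≗_; refl; sym; trans; cong; cong₂; subst; module ≡-Reasoning)
import Relation.Binary.PropositionalEquality as ≡
open import Relation.Binary.Structures using (IsPartialEquivalence)
open import Relation.Nullary using (¬_; Dec; yes; no; does; contradiction)
open import Relation.Nullary.Decidable using (does-⇔; T?; _×-dec_)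

open import Defs

module ListSum {A : Set} {_+_ _*_ : Op₂ A} {0# 1# : A} (isSemiring : IsSemiring _≡_ _+_ _*_ 0# 1#) where

  open IsSemiring isSemiring
    using (+-isCommutativeSemigroup; +-identityˡ; +-identityʳ; +-assoc; distribˡ; distribʳ; zeroˡ; zeroʳ)

  +-commutativeSemigroup : CommutativeSemigroup 0ℓ 0ℓ
  +-commutativeSemigroup = record { isCommutativeSemigroup = +-isCommutativeSemigroup }

  open import Algebra.Properties.CommutativeSemigroup +-commutativeSemigroup using (interchange)

  ∑ : {X : Set} → List X → (X → A) → A
  ∑ xs f = foldr _+_ 0# (map f xs)

  syntax ∑ xs (λ x → e) = ∑[ x ∈ xs ] e

  module _ {X : Set} where

    ∑-cong : ∀ (xs : List X) {f g : X → A} → (∀ x → f x ≡ g x) → ∑ xs f ≡ ∑ xs g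
    ∑-cong []       f≗g = refl
    ∑-cong (x ∷ xs) f≗g = cong₂ _+_ (f≗g x) (∑-cong xs f≗g)

    ∑-cong-All : ∀ {xs : List X} {f g : X → A} → All (λ x → f x ≡ g x) xs → ∑ xs f ≡ ∑ xs g
    ∑-cong-All []              = refl
    ∑-cong-All (fx≡gx ∷ f≗gxs) = cong₂ _+_ fx≡gx (∑-cong-All f≗gxs)

    ∑-zero : ∀ {xs : List X} {f : X → A} → All (λ x → f x ≡ 0#) xs → ∑ xs f ≡ 0#
    ∑-zero []             = refl
    ∑-zero (fx≡0 ∷ fxs≡0) = trans (cong₂ _+_ fx≡0 (∑-zero fxs≡0)) (+-identityˡ 0#)

    ∑-distrib-+ : ∀ (xs : List X) (f g : X → A) → ∑[ x ∈ xs ] (f x + g x) ≡ ∑ xs f + ∑ xs g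
    ∑-distrib-+ []       f g = sym (+-identityˡ 0#)
    ∑-distrib-+ (x ∷ xs) f g = trans (cong ((f x + g x) +_) (∑-distrib-+ xs f g)) (interchange _ _ _ _)

    *-distribˡ-∑ : ∀ c (xs : List X) (f : X → A) → c * ∑ xs f ≡ ∑[ x ∈ xs ] (c * f x)
    *-distribˡ-∑ c []       f = zeroʳ c
    *-distribˡ-∑ c (x ∷ xs) f = trans (distribˡ c (f x) _) (cong ((c * f x) +_) (*-distribˡ-∑ c xs f))

    *-distribʳ-∑ : ∀ c (xs : List X) (f : X → A) → ∑ xs f * c ≡ ∑[ x ∈ xs ] (f x * c)
    *-distribʳ-∑ c []       f = zeroˡ c
    *-distribʳ-∑ c (x ∷ xs) f = trans (distribʳ c (f x) _) (cong ((f x * c) +_) (*-distribʳ-∑ c xs f))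

    ∑-++ : ∀ (xs ys : List X) (f : X → A) → ∑ (xs ++ ys) f ≡ ∑ xs f + ∑ ys f
    ∑-++ []       ys f = sym (+-identityˡ _)
    ∑-++ (x ∷ xs) ys f = trans (cong (f x +_) (∑-++ xs ys f)) (sym (+-assoc _ _ _))

  module _ {X Y : Set} where

    ∑-comm : ∀ (xs : List X) (ys : List Y) (f : X → Y → A) →
             ∑[ x ∈ xs ] ∑[ y ∈ ys ] f x y ≡ ∑[ y ∈ ys ] ∑[ x ∈ xs ] f x y
    ∑-comm []       ys f = sym (∑-zero (All.universal (λ _ → refl) ys))
    ∑-comm (x ∷ xs) ys f = trans (cong (∑ ys (f x) +_) (∑-comm xs ys f)) (sym (∑-distrib-+ ys (f x) _))

    ∑-map : ∀ (g : X → Y) (xs : List X) (f : Y → A) → ∑ (map g xs) f ≡ ∑ xs (f ∘ g)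
    ∑-map g []       f = refl
    ∑-map g (x ∷ xs) f = cong (f (g x) +_) (∑-map g xs f)

    ∑-concatMap : ∀ (g : X → List Y) (xs : List X) (f : Y → A) →
                  ∑ (concatMap g xs) f ≡ ∑[ x ∈ xs ] ∑ (g x) f
    ∑-concatMap g []       f = refl
    ∑-concatMap g (x ∷ xs) f = trans (∑-++ (g x) (concatMap g xs) f) (cong (∑ (g x) f +_) (∑-concatMap g xs f))

  module _ {X : Set} {_~_ : Rel X 0ℓ} (isPartialEquivalence : IsPartialEquivalence _~_) where
    open IsPartialEquivalence isPartialEquivalence renaming (sym to ~-sym; trans to ~-trans)

    ∑-transversal : ∀ {xs : List X} {a} (f : X → A) →
                    (∀ i j → lookup xs i ~ lookup xs j → i ≡ j) → (a~ : Any (a ~_) xs) →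
                    (∀ x → ¬ a ~ x → f x ≡ 0#) → ∑ xs f ≡ f (lookup xs (index a~))
    ∑-transversal {x ∷ xs} {a} f uniq (here a~x) vanish =
      trans (cong (f x +_) (∑-zero (All.tabulate λ y∈xs → vanish _ (apart y∈xs)))) (+-identityʳ (f x))
      where
      apart : ∀ {y} → y ∈ xs → ¬ a ~ y
      apart y∈xs a~y with uniq zero (suc (index y∈xs)) (~-trans (~-sym a~x) (subst (a ~_) (lookup-index y∈xs) a~y))
      ... | ()
    ∑-transversal {x ∷ xs} {a} f uniq (there a~) vanish =
      trans (cong₂ _+_ (vanish x apart) (∑-transversal f (λ i j → suc-injective ∘ uniq (suc i) (suc j)) a~ vanish))
            (+-identityˡ _)
      where
      apart : ¬ a ~ x
      apart a~x with uniq (suc (index a~)) zero (~-trans (~-sym (lookup-index a~)) a~x)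
      ... | ()

module ℕ∑ = ListSum ℕP.+-*-isSemiring
module ℚ∑ = ListSum (IsRing.isSemiring ℚP.+-*-isRing)

open ℕ∑ using (∑; ∑-cong; ∑-comm; ∑-map; ∑-concatMap; *-distribˡ-∑; *-distribʳ-∑)

[_] : Bool → ℕ
[ true ]  = 1
[ false ] = 0

[∧] : ∀ a b → [ a ∧ b ] ≡ [ a ] ℕ.* [ b ]
[∧] true  b = sym (ℕP.+-identityʳ [ b ])
[∧] false b = refl

T-injective : ∀ {a b} → T a ⇔ T b → a ≡ b
T-injective {a} {b} a⇔b = does-⇔ a⇔b (T? a) (T? b)

reflects-≡ : ∀ {a b} {A B : Set} → T a ⇔ A → T b ⇔ B → A ⇔ B → a ≡ b
reflects-≡ a⇔A b⇔B A⇔B = T-injective (⇔-sym b⇔B ⇔-∘ (A⇔B ⇔-∘ a⇔A))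

T-does : ∀ {P : Set} (P? : Dec P) → T (does P?) ⇔ P
T-does (yes p) = mk⇔ (λ _ → p) _
T-does (no ¬p) = mk⇔ (λ ()) ¬p

∧-reflects : ∀ {a b} {A B : Set} → T a ⇔ A → T b ⇔ B → T (a ∧ b) ⇔ (A × B)
∧-reflects {a} a⇔A b⇔B = (a⇔A ×-⇔ b⇔B) ⇔-∘ T-∧ {a}

→-reflects : ∀ {a b} {A B : Set} → T a ⇔ A → T b ⇔ B → T (not a ∨ b) ⇔ (A → B)
→-reflects {true}  a⇔A b⇔B =
  mk⇔ (λ b _ → Equivalence.to b⇔B b) (λ A→B → Equivalence.from b⇔B (A→B (Equivalence.to a⇔A _)))
→-reflects {false} a⇔A b⇔B = mk⇔ (λ _ → ⊥-elim ∘ Equivalence.from a⇔A) _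

forall?-reflects : ∀ {n} {p : Fin n → Bool} {P : Fin n → Set} →
                   (∀ i → T (p i) ⇔ P i) → T (forall? n p) ⇔ (∀ i → P i)
forall?-reflects {n} {p} p⇔P = mk⇔
  (λ ∀p i → Equivalence.to (p⇔P i) (All.lookup (all⁺ p (allFin n) ∀p) (∈-allFin i)))
  (λ ∀P → all⁻ p (All.tabulate {xs = allFin n} (λ {i} _ → Equivalence.from (p⇔P i) (∀P i))))

exists?-reflects : ∀ {n} {p : Fin n → Bool} {P : Fin n → Set} →
                   (∀ i → T (p i) ⇔ P i) → T (exists? n p) ⇔ ∃ P
exists?-reflects {n} {p} p⇔P = mk⇔
  (λ ∃p → let (i , pi) = Any.satisfied (any⁻ p (allFin n) ∃p) in i , Equivalence.to (p⇔P i) pi)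
  (λ (i , Pi) → any⁺ p (Any.map (λ { refl → Equivalence.from (p⇔P i) Pi }) (∈-allFin i)))

==ᵇ-reflects : ∀ {a b} → T (a ==ᵇ b) ⇔ a ≡ b
==ᵇ-reflects {a} {b} = subst (λ c → T c ⇔ a ≡ b) (does≡==ᵇ a b) (T-does (a Bool.≟ b))
  where
  does≡==ᵇ : ∀ a b → does (a Bool.≟ b) ≡ (a ==ᵇ b)
  does≡==ᵇ true  true  = refl
  does≡==ᵇ true  false = refl
  does≡==ᵇ false true  = refl
  does≡==ᵇ false false = refl

module _ {X : Set} where

  count-∷ : ∀ (p : X → Bool) x xs → count p (x ∷ xs) ≡ [ p x ] ℕ.+ count p xs
  count-∷ p x xs with p x
  ... | true  = refl
  ... | false = refl

  count≡∑ : ∀ (p : X → Bool) xs → count p xs ≡ ∑[ x ∈ xs ] [ p x ]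
  count≡∑ p []       = refl
  count≡∑ p (x ∷ xs) = trans (count-∷ p x xs) (cong ([ p x ] ℕ.+_) (count≡∑ p xs))

  count-cong : ∀ {p q : X → Bool} xs → (∀ x → p x ≡ q x) → count p xs ≡ count q xs
  count-cong {p} {q} xs p≗q = begin
    count p xs          ≡⟨ count≡∑ p xs ⟩
    ∑[ x ∈ xs ] [ p x ] ≡⟨ ∑-cong xs (cong [_] ∘ p≗q) ⟩
    ∑[ x ∈ xs ] [ q x ] ≡⟨ count≡∑ q xs ⟨
    count q xs          ∎
    where open ≡-Reasoning

  count-none : ∀ {p : X → Bool} xs → (∀ x → ¬ T (p x)) → count p xs ≡ 0
  count-none {p} xs ¬p = cong length (filter-none (T? ∘ p) (All.universal ¬p xs))

  any⇒count-nonZero : ∀ {p : X → Bool} {xs} → Any (T ∘ p) xs → NonZero (count p xs)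
  any⇒count-nonZero {p} p∈xs = >-nonZero (filter-some (T? ∘ p) p∈xs)

  count≢0⇒any : ∀ {p : X → Bool} xs → count p xs ≢ 0 → Any (T ∘ p) xs
  count≢0⇒any     []       count≢0 = contradiction refl count≢0
  count≢0⇒any {p} (x ∷ xs) count≢0 with p x in px
  ... | true  = here (Equivalence.from T-≡ px)
  ... | false = there (count≢0⇒any xs count≢0)

count-map : ∀ {X Y : Set} (p : Y → Bool) (g : X → Y) xs → count p (map g xs) ≡ count (p ∘ g) xs
count-map p g xs = trans (count≡∑ p (map g xs)) (trans (∑-map g xs _) (sym (count≡∑ (p ∘ g) xs)))

-- Enumerations up to a decidable equivalence

module Enumeration (D : DecSetoid 0ℓ 0ℓ) where
  open DecSetoid D using (_≈_; _≟_; setoid) renaming (Carrier to B; sym to ≈-sym)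

  _≟ᵇ_ : B → B → Bool
  x ≟ᵇ y = does (x ≟ y)

  record Enumerates (xs : List B) : Set where
    constructor enumerates
    field occurs-once : ∀ b → count (_≟ᵇ b) xs ≡ 1

  open Enumerates public

  module _ {xs : List B} (enum : Enumerates xs) where

    ∑-indicator : ∀ b c → ∑[ x ∈ xs ] ([ x ≟ᵇ b ] ℕ.* c) ≡ c
    ∑-indicator b c = begin
      ∑[ x ∈ xs ] ([ x ≟ᵇ b ] ℕ.* c) ≡⟨ *-distribʳ-∑ c xs _ ⟨
      ∑[ x ∈ xs ] [ x ≟ᵇ b ] ℕ.* c   ≡⟨ cong (ℕ._* c) (trans (sym (count≡∑ _ xs)) (occurs-once enum b)) ⟩
      1 ℕ.* c                        ≡⟨ ℕP.*-identityˡ c ⟩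
      c                              ∎
      where open ≡-Reasoning

    count-nonZero : ∀ {p : B → Bool} → (T ∘ p) Respects _≈_ → ∀ {b} → T (p b) → NonZero (count p xs)
    count-nonZero {p} p-resp {b} pb = any⇒count-nonZero (Any.map p-holds b-occurs)
      where
      b-occurs : Any (λ x → T (x ≟ᵇ b)) xs
      b-occurs = count≢0⇒any xs (λ count≡0 → ℕP.1+n≢0 (trans (sym (occurs-once enum b)) count≡0))
      p-holds : ∀ {x} → T (x ≟ᵇ b) → T (p x)
      p-holds {x} x≈b = p-resp (≈-sym (Equivalence.to (T-does (x ≟ b)) x≈b)) pb

  -- Both sides equal the number of pairs (x, y) with x ≈ y and p y.
  count-enumerations : ∀ {xs ys} → Enumerates xs → Enumerates ys →
                       ∀ {p : B → Bool} → (T ∘ p) Respects _≈_ → count p xs ≡ count p ys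
  count-enumerations {xs} {ys} xs-enum ys-enum {p} p-resp = begin
    count p xs
      ≡⟨ count≡∑ p xs ⟩
    ∑[ x ∈ xs ] [ p x ]
      ≡⟨ ∑-cong xs (λ x → ∑-indicator ys-enum x [ p x ]) ⟨
    ∑[ x ∈ xs ] ∑[ y ∈ ys ] ([ y ≟ᵇ x ] ℕ.* [ p x ])
      ≡⟨ ∑-cong xs (λ x → ∑-cong ys (λ y → transfer y x)) ⟩
    ∑[ x ∈ xs ] ∑[ y ∈ ys ] ([ x ≟ᵇ y ] ℕ.* [ p y ])
      ≡⟨ ∑-comm xs ys _ ⟩
    ∑[ y ∈ ys ] ∑[ x ∈ xs ] ([ x ≟ᵇ y ] ℕ.* [ p y ])
      ≡⟨ ∑-cong ys (λ y → ∑-indicator xs-enum y [ p y ]) ⟩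
    ∑[ y ∈ ys ] [ p y ]
      ≡⟨ count≡∑ p ys ⟨
    count p ys ∎
    where
    open ≡-Reasoning
    transfer : ∀ y x → [ y ≟ᵇ x ] ℕ.* [ p x ] ≡ [ x ≟ᵇ y ] ℕ.* [ p y ]
    transfer y x with y ≟ x | x ≟ y
    ... | yes y≈x | yes _   = cong (λ b → 1 ℕ.* [ b ]) (T-injective (mk⇔ (p-resp (≈-sym y≈x)) (p-resp y≈x)))
    ... | yes y≈x | no x≉y  = contradiction (≈-sym y≈x) x≉y
    ... | no y≉x  | yes x≈y = contradiction (≈-sym x≈y) y≉x
    ... | no _    | no _    = refl

  map-enumerates : ∀ {xs} → Enumerates xs → (I : Inverse setoid setoid) → Enumerates (map (Inverse.to I) xs)
  map-enumerates {xs} enum I = enumerates once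
    where
    open Inverse I
    once : ∀ b → count (_≟ᵇ b) (map to xs) ≡ 1
    once b = begin
      count (_≟ᵇ b) (map to xs)  ≡⟨ count-map (_≟ᵇ b) to xs ⟩
      count (λ x → to x ≟ᵇ b) xs ≡⟨ count-cong xs (λ x → does-⇔ to≈⇔≈from (to x ≟ b) (x ≟ from b)) ⟩
      count (_≟ᵇ from b) xs      ≡⟨ occurs-once enum (from b) ⟩
      1                          ∎
      where
      open ≡-Reasoning
      to≈⇔≈from : ∀ {x} → to x ≈ b ⇔ x ≈ from b
      to≈⇔≈from = mk⇔ (λ to-x≈b → ≈-sym (inverseʳ (≈-sym to-x≈b))) inverseˡ

  count-∘-inverse : ∀ {xs} → Enumerates xs → ∀ {p : B → Bool} → (T ∘ p) Respects _≈_ →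
                    (I : Inverse setoid setoid) → count (p ∘ Inverse.to I) xs ≡ count p xs
  count-∘-inverse {xs} enum {p} p-resp I =
    trans (sym (count-map p (Inverse.to I) xs)) (count-enumerations (map-enumerates enum I) enum p-resp)

open Enumeration using (Enumerates; enumerates; occurs-once; count-∘-inverse)

Fin-decSetoid : ℕ → DecSetoid 0ℓ 0ℓ
Fin-decSetoid n = ≡.decSetoid (Fin._≟_ {n})

Bool-decSetoid : DecSetoid 0ℓ 0ℓ
Bool-decSetoid = ≡.decSetoid Bool._≟_

count-allFin-suc : ∀ {n} (p : Fin (suc n) → Bool) →
                   count p (allFin (suc n)) ≡ [ p zero ] ℕ.+ count (p ∘ suc) (allFin n)
count-allFin-suc {n} p = trans (count-∷ p zero _) (cong ([ p zero ] ℕ.+_) (begin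
  count p (tabulate suc)       ≡⟨ cong (count p) (map-tabulate id suc) ⟨
  count p (map suc (allFin n)) ≡⟨ count-map p suc (allFin n) ⟩
  count (p ∘ suc) (allFin n)   ∎))
  where open ≡-Reasoning

allFin-enumerates : ∀ n → Enumerates (Fin-decSetoid n) (allFin n)
allFin-enumerates n = enumerates (once n)
  where
  once : ∀ n (b : Fin n) → count (_==ᶠ b) (allFin n) ≡ 1
  once (suc n) b = trans (count-allFin-suc (_==ᶠ b)) (rest b)
    where
    rest : ∀ b → [ zero ==ᶠ b ] ℕ.+ count (λ x → suc x ==ᶠ b) (allFin n) ≡ 1
    rest zero    = cong suc (count-none (allFin n) (λ _ ()))
    rest (suc b) = once n b

booleans-enumerate : Enumerates Bool-decSetoid (true ∷ false ∷ [])
booleans-enumerate = enumerates λ { true → refl ; false → refl }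

module _ (D : DecSetoid 0ℓ 0ℓ) where
  open DecSetoid D using (_≟_) renaming (Carrier to B)
  open Enumeration D using (_≟ᵇ_)

  _≋ᵇ_ : ∀ {m} → (Fin m → B) → (Fin m → B) → Bool
  _≋ᵇ_ {m} = Enumeration._≟ᵇ_ (Pointwise.decSetoid D m)

  ≋ᵇ-suc : ∀ {m} (f g : Fin (suc m) → B) → f ≋ᵇ g ≡ f zero ≟ᵇ g zero ∧ (f ∘ suc) ≋ᵇ (g ∘ suc)
  ≋ᵇ-suc f g = does-⇔ head-tail (Pointwise.decidable _≟_ f g)
                                (f zero ≟ g zero ×-dec Pointwise.decidable _≟_ (f ∘ suc) (g ∘ suc))
    where
    head-tail = mk⇔ (λ f≋g → f≋g zero , f≋g ∘ suc)
                    (λ { (f₀≈g₀ , _) zero → f₀≈g₀ ; (_ , fₛ≋gₛ) (suc i) → fₛ≋gₛ i })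

  allFunsTo-enumerates : ∀ {xs} → Enumerates D xs → ∀ m → Enumerates (Pointwise.decSetoid D m) (allFunsTo xs m)
  allFunsTo-enumerates       enum zero    = enumerates λ _ → refl
  allFunsTo-enumerates {xs} enum (suc m) = enumerates once
    where
    open ≡-Reasoning
    Fs = allFunsTo xs m
    once : ∀ b → count (_≋ᵇ b) (allFunsTo xs (suc m)) ≡ 1
    once b = begin
      count (_≋ᵇ b) (allFunsTo xs (suc m))
        ≡⟨ count≡∑ _ (allFunsTo xs (suc m)) ⟩
      ∑ (allFunsTo xs (suc m)) (λ f → [ f ≋ᵇ b ])
        ≡⟨ ∑-concatMap _ Fs _ ⟩
      ∑[ f ∈ Fs ] ∑ (map _ xs) (λ g → [ g ≋ᵇ b ])
        ≡⟨ ∑-cong Fs (λ f → trans (∑-cong (map _ xs) (λ g → cong [_] (≋ᵇ-suc g b))) (∑-map _ xs _)) ⟩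
      ∑[ f ∈ Fs ] ∑[ a ∈ xs ] [ a ≟ᵇ b zero ∧ f ≋ᵇ (b ∘ suc) ]
        ≡⟨ ∑-cong Fs (λ f → ∑-cong xs (λ a → [∧] (a ≟ᵇ b zero) (f ≋ᵇ (b ∘ suc)))) ⟩
      ∑[ f ∈ Fs ] ∑[ a ∈ xs ] ([ a ≟ᵇ b zero ] ℕ.* [ f ≋ᵇ (b ∘ suc) ])
        ≡⟨ ∑-cong Fs (λ f → Enumeration.∑-indicator D enum (b zero) _) ⟩
      ∑[ f ∈ Fs ] [ f ≋ᵇ (b ∘ suc) ]
        ≡⟨ count≡∑ _ Fs ⟨
      count (_≋ᵇ (b ∘ suc)) Fs
        ≡⟨ occurs-once (allFunsTo-enumerates enum m) (b ∘ suc) ⟩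
      1 ∎

module _ (S : Setoid 0ℓ 0ℓ) {m : ℕ} where
  open Setoid S using () renaming (trans to ≈-trans; reflexive to ≈-reflexive)

  precompose : Permutation m m → Inverse (Pointwise.setoid S m) (Pointwise.setoid S m)
  precompose π = record
    { to        = _∘ (π ⟨$⟩ʳ_)
    ; from      = _∘ (π ⟨$⟩ˡ_)
    ; to-cong   = λ f≋g → f≋g ∘ (π ⟨$⟩ʳ_)
    ; from-cong = λ f≋g → f≋g ∘ (π ⟨$⟩ˡ_)
    ; inverse   = (λ {f} g≋f∘π⁻¹ i → ≈-trans (g≋f∘π⁻¹ (π ⟨$⟩ʳ i)) (≈-reflexive (cong f (Perm.inverseˡ π))))
                , (λ {f} g≋f∘π   i → ≈-trans (g≋f∘π (π ⟨$⟩ˡ i)) (≈-reflexive (cong f (Perm.inverseʳ π))))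
    }

  postcompose : Inverse S S → Inverse (Pointwise.setoid S m) (Pointwise.setoid S m)
  postcompose σ = record
    { to        = to ∘_
    ; from      = from ∘_
    ; to-cong   = to-cong ∘_
    ; from-cong = from-cong ∘_
    ; inverse   = (inverseˡ ∘_) , (inverseʳ ∘_)
    }
    where open Inverse σ

count-∘-permutation : ∀ {n} (π : Permutation n n) (p : Fin n → Bool) →
                      count (p ∘ (π ⟨$⟩ʳ_)) (allFin n) ≡ count p (allFin n)
count-∘-permutation {n} π p = count-∘-inverse (Fin-decSetoid n) (allFin-enumerates n) (≡.resp (T ∘ p)) π

-- Isomorphisms of graphs and of rooted graphs on Fin n

module _ {n : ℕ} where

  HasInverse : (Fin n → Fin n) → Set
  HasInverse f = Σ (Fin n → Fin n) λ g → (∀ x → g (f x) ≡ x) × (∀ y → f (g y) ≡ y)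

  Bijective : (Fin n → Fin n) → Set
  Bijective f = (∀ u v → f u ≡ f v → u ≡ v) × (∀ y → ∃ λ x → f x ≡ y)

  bijective⇔hasInverse : ∀ {f} → Bijective f ⇔ HasInverse f
  bijective⇔hasInverse {f} = mk⇔
    (λ (injective , surjective) →
       let g = proj₁ ∘ surjective; f∘g≗id = proj₂ ∘ surjective
       in g , (λ x → injective _ _ (f∘g≗id (f x))) , f∘g≗id)
    (λ (g , g∘f≗id , f∘g≗id) →
       (λ u v fu≡fv → trans (sym (g∘f≗id u)) (trans (cong g fu≡fv) (g∘f≗id v))) , (λ y → g y , f∘g≗id y))

  isBijectionᵇ-reflects : ∀ {f} → T (isBijectionᵇ f) ⇔ HasInverse f
  isBijectionᵇ-reflects {f} = bijective⇔hasInverse ⇔-∘ ∧-reflects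
    (forall?-reflects λ u → forall?-reflects λ v → →-reflects (T-does (f u Fin.≟ f v)) (T-does (u Fin.≟ v)))
    (forall?-reflects λ y → exists?-reflects λ x → T-does (f x Fin.≟ y))

  -- Shaped so that Iso G H and RootedIso P Q are, definitionally, Σ-types over these predicates.
  IsIso : Graph n → Graph n → (Fin n → Fin n) → Set
  IsIso G H f = Σ (Fin n → Fin n) λ g →
    (∀ x → g (f x) ≡ x) × (∀ y → f (g y) ≡ y) × (∀ u v → H (f u) (f v) ≡ G u v)

  IsRootedIso : Graph n × Fin n → Graph n × Fin n → (Fin n → Fin n) → Set
  IsRootedIso (G , r) (H , s) f = Σ (Fin n → Fin n) λ g →
    (∀ x → g (f x) ≡ x) × (∀ y → f (g y) ≡ y) × (∀ u v → H (f u) (f v) ≡ G u v) × (f r ≡ s)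

  IsIso-id : ∀ {G : Graph n} → IsIso G G id
  IsIso-id = id , (λ _ → refl) , (λ _ → refl) , (λ _ _ → refl)

  IsRootedIso-id : ∀ {P : Graph n × Fin n} → IsRootedIso P P id
  IsRootedIso-id = id , (λ _ → refl) , (λ _ → refl) , (λ _ _ → refl) , refl

  IsIso-resp : ∀ {G H : Graph n} {f f′} → f ≗ f′ → IsIso G H f → IsIso G H f′
  IsIso-resp {H = H} f≗f′ (g , g∘f≗id , f∘g≗id , sends) =
    g , (λ x → trans (cong g (sym (f≗f′ x))) (g∘f≗id x)) , (λ y → trans (sym (f≗f′ (g y))) (f∘g≗id y)) ,
    (λ u v → trans (sym (cong₂ H (f≗f′ u) (f≗f′ v))) (sends u v))

  IsRootedIso-resp : ∀ {P Q : Graph n × Fin n} {f f′} → f ≗ f′ → IsRootedIso P Q f → IsRootedIso P Q f′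
  IsRootedIso-resp {G , r} {H , _} f≗f′ (g , g∘f≗id , f∘g≗id , sends , root) =
    let (_ , g∘f′≗id , f′∘g≗id , sends′) = IsIso-resp {G} {H} f≗f′ (g , g∘f≗id , f∘g≗id , sends)
    in g , g∘f′≗id , f′∘g≗id , sends′ , trans (sym (f≗f′ r)) root

  iso-sym : ∀ {G H : Graph n} → Iso G H → Iso H G
  iso-sym {H = H} (f , g , g∘f≗id , f∘g≗id , sends) =
    g , f , f∘g≗id , g∘f≗id ,
    (λ u v → sym (trans (sym (cong₂ H (f∘g≗id u) (f∘g≗id v))) (sends (g u) (g v))))

  iso-trans : ∀ {G H K : Graph n} → Iso G H → Iso H K → Iso G K
  iso-trans (f , g , g∘f≗id , f∘g≗id , sends) (f′ , g′ , g′∘f′≗id , f′∘g′≗id , sends′) =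
    f′ ∘ f , g ∘ g′ ,
    (λ x → trans (cong g (g′∘f′≗id (f x))) (g∘f≗id x)) ,
    (λ y → trans (cong f′ (f∘g≗id (g′ y))) (f′∘g′≗id y)) ,
    (λ u v → trans (sends′ (f u) (f v)) (sends u v))

  rootedIso⇒iso : ∀ {G H : Graph n} {r s} → RootedIso (G , r) (H , s) → Iso G H
  rootedIso⇒iso (f , g , g∘f≗id , f∘g≗id , sends , _) = f , g , g∘f≗id , f∘g≗id , sends

  rootedIso-sym : ∀ {P Q : Graph n × Fin n} → RootedIso P Q → RootedIso Q P
  rootedIso-sym {G , r} {H , _} (f , g , g∘f≗id , f∘g≗id , sends , root) =
    let (_ , _ , _ , _ , sends⁻¹) = iso-sym {G} {H} (f , g , g∘f≗id , f∘g≗id , sends)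
    in g , f , f∘g≗id , g∘f≗id , sends⁻¹ , trans (cong g (sym root)) (g∘f≗id r)

  rootedIso-trans : ∀ {P Q R : Graph n × Fin n} → RootedIso P Q → RootedIso Q R → RootedIso P R
  rootedIso-trans {G , _} {H , _} {K , _} (f , g , l , r , sends , root) (f′ , g′ , l′ , r′ , sends′ , root′) =
    let (_ , _ , l″ , r″ , sends″) = iso-trans {G} {H} {K} (f , g , l , r , sends) (f′ , g′ , l′ , r′ , sends′)
    in f′ ∘ f , g ∘ g′ , l″ , r″ , sends″ , trans (cong f′ root) root′

  iso-isPartialEquivalence : IsPartialEquivalence (Iso {n})
  iso-isPartialEquivalence = record
    { sym   = λ {G H} → iso-sym {G} {H}
    ; trans = λ {G H K} → iso-trans {G} {H} {K}
    }

  rootedIso-isPartialEquivalence : IsPartialEquivalence (RootedIso {n})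
  rootedIso-isPartialEquivalence = record
    { sym   = λ {P Q} → rootedIso-sym {P} {Q}
    ; trans = λ {P Q R} → rootedIso-trans {P} {Q} {R}
    }

  Iso⇒Permutation : ∀ {G H : Graph n} → Iso G H → Permutation n n
  Iso⇒Permutation (f , g , g∘f≗id , f∘g≗id , _) = Perm.permutation f g f∘g≗id g∘f≗id

  sendsᵇ : Graph n → Graph n → (Fin n → Fin n) → Bool
  sendsᵇ G H f = forall? n (λ u → forall? n (λ v → H (f u) (f v) ==ᵇ G u v))

  isIsoᵇ : Graph n → Graph n → (Fin n → Fin n) → Bool
  isIsoᵇ G H f = isBijectionᵇ f ∧ sendsᵇ G H f

  isRootedIsoᵇ : Graph n × Fin n → Graph n × Fin n → (Fin n → Fin n) → Bool
  isRootedIsoᵇ (G , r) (H , s) f = isBijectionᵇ f ∧ sendsᵇ G H f ∧ (f r ==ᶠ s)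

  sendsᵇ-reflects : ∀ {G H : Graph n} {f} → T (sendsᵇ G H f) ⇔ (∀ u v → H (f u) (f v) ≡ G u v)
  sendsᵇ-reflects = forall?-reflects λ u → forall?-reflects λ v → ==ᵇ-reflects

  isIsoᵇ-reflects : ∀ {G H : Graph n} {f} → T (isIsoᵇ G H f) ⇔ IsIso G H f
  isIsoᵇ-reflects {G} {H} {f} =
    mk⇔ (λ ((g , l , r) , sends) → g , l , r , sends) (λ (g , l , r , sends) → (g , l , r) , sends)
    ⇔-∘ ∧-reflects (isBijectionᵇ-reflects {f}) (sendsᵇ-reflects {G} {H} {f})

  isRootedIsoᵇ-reflects : ∀ {P Q : Graph n × Fin n} {f} → T (isRootedIsoᵇ P Q f) ⇔ IsRootedIso P Q f
  isRootedIsoᵇ-reflects {G , r} {H , s} {f} =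
    mk⇔ (λ ((g , l , r) , sends , root) → g , l , r , sends , root)
        (λ (g , l , r , sends , root) → (g , l , r) , sends , root)
    ⇔-∘ ∧-reflects (isBijectionᵇ-reflects {f}) (∧-reflects (sendsᵇ-reflects {G} {H} {f}) (T-does (f r Fin.≟ s)))

  isIsoᵇ-resp : ∀ {G H : Graph n} → (T ∘ isIsoᵇ G H) Respects _≗_
  isIsoᵇ-resp {G} {H} f≗f′ =
    Equivalence.from (isIsoᵇ-reflects {G} {H}) ∘ IsIso-resp {G} {H} f≗f′ ∘ Equivalence.to (isIsoᵇ-reflects {G} {H})

  isRootedIsoᵇ-resp : ∀ {P Q : Graph n × Fin n} → (T ∘ isRootedIsoᵇ P Q) Respects _≗_
  isRootedIsoᵇ-resp {P} {Q} f≗f′ =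
    Equivalence.from (isRootedIsoᵇ-reflects {P} {Q}) ∘ IsRootedIso-resp {P} {Q} f≗f′ ∘
    Equivalence.to (isRootedIsoᵇ-reflects {P} {Q})

  allMaps : List (Fin n → Fin n)
  allMaps = allFunsTo (allFin n) n

  Maps-decSetoid : DecSetoid 0ℓ 0ℓ
  Maps-decSetoid = Pointwise.decSetoid (Fin-decSetoid n) n

  allMaps-enumerates : Enumerates Maps-decSetoid allMaps
  allMaps-enumerates = allFunsTo-enumerates (Fin-decSetoid n) (allFin-enumerates n) n

  -- autCount G and rootedAutCount P are, definitionally, isoCount G G and rootedIsoCount P P.
  isoCount : Graph n → Graph n → ℕ
  isoCount G H = count (isIsoᵇ G H) allMaps

  rootedIsoCount : Graph n × Fin n → Graph n × Fin n → ℕ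
  rootedIsoCount P Q = count (isRootedIsoᵇ P Q) allMaps

  isoCount-congʳ : ∀ {G H H′ : Graph n} → Iso H H′ → isoCount G H ≡ isoCount G H′
  isoCount-congʳ {G} {H} {H′} ψ@(ψ→ , _ , ψ←∘ψ→≗id , _) = begin
    count (isIsoᵇ G H) allMaps
      ≡⟨ count-cong allMaps (λ f → reflects-≡ (isIsoᵇ-reflects {G} {H}) (isIsoᵇ-reflects {G} {H′})
                                               (compose f)) ⟩
    count (isIsoᵇ G H′ ∘ (ψ→ ∘_)) allMaps
      ≡⟨ count-∘-inverse Maps-decSetoid allMaps-enumerates (isIsoᵇ-resp {G} {H′})
                         (postcompose (≡.setoid (Fin n)) (Iso⇒Permutation {H} {H′} ψ)) ⟩
    count (isIsoᵇ G H′) allMaps ∎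
    where
    open ≡-Reasoning
    compose : ∀ f → IsIso G H f ⇔ IsIso G H′ (ψ→ ∘ f)
    compose f = mk⇔
      (λ f-iso → proj₂ (iso-trans {G} {H} {H′} (f , f-iso) ψ))
      (λ ψ→∘f-iso → IsIso-resp {G} {H} (ψ←∘ψ→≗id ∘ f)
                      (proj₂ (iso-trans {G} {H′} {H} (ψ→ ∘ f , ψ→∘f-iso) (iso-sym {H} {H′} ψ))))

  rootedIsoCount-congˡ : ∀ {P P′ Q : Graph n × Fin n} → RootedIso P P′ →
                         rootedIsoCount P Q ≡ rootedIsoCount P′ Q
  rootedIsoCount-congˡ {P} {P′} {Q} φ@(φ→ , φ← , φ←∘φ→≗id , φ→∘φ←≗id , _) = begin
    count (isRootedIsoᵇ P Q) allMaps
      ≡⟨ count-cong allMaps (λ f → reflects-≡ (isRootedIsoᵇ-reflects {P} {Q}) (isRootedIsoᵇ-reflects {P′} {Q})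
                                               (compose f)) ⟩
    count (isRootedIsoᵇ P′ Q ∘ (_∘ φ←)) allMaps
      ≡⟨ count-∘-inverse Maps-decSetoid allMaps-enumerates (isRootedIsoᵇ-resp {P′} {Q})
                         (precompose (≡.setoid (Fin n)) φ←-permutation) ⟩
    count (isRootedIsoᵇ P′ Q) allMaps ∎
    where
    open ≡-Reasoning
    φ←-permutation = Perm.permutation φ← φ→ φ←∘φ→≗id φ→∘φ←≗id
    compose : ∀ f → IsRootedIso P Q f ⇔ IsRootedIso P′ Q (f ∘ φ←)
    compose f = mk⇔
      (λ f-iso → proj₂ (rootedIso-trans {P′} {P} {Q} (rootedIso-sym {P} {P′} φ) (f , f-iso)))
      (λ f∘φ←-iso → IsRootedIso-resp {P} {Q} (cong f ∘ φ←∘φ→≗id)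
                      (proj₂ (rootedIso-trans {P} {P′} {Q} φ (f ∘ φ← , f∘φ←-iso))))

  rootedIsoCount-≡0 : ∀ {P Q : Graph n × Fin n} → ¬ RootedIso P Q → rootedIsoCount P Q ≡ 0
  rootedIsoCount-≡0 {P} {Q} ¬iso =
    count-none allMaps (λ f f-iso → ¬iso (f , Equivalence.to (isRootedIsoᵇ-reflects {P} {Q}) f-iso))

  autCount-nonZero : ∀ (G : Graph n) → NonZero (autCount G)
  autCount-nonZero G = Enumeration.count-nonZero Maps-decSetoid allMaps-enumerates (isIsoᵇ-resp {G} {G})
                         (Equivalence.from (isIsoᵇ-reflects {G} {G}) IsIso-id)

  rootedAutCount-nonZero : ∀ (P : Graph n × Fin n) → NonZero (rootedAutCount P)
  rootedAutCount-nonZero P = Enumeration.count-nonZero Maps-decSetoid allMaps-enumerates (isRootedIsoᵇ-resp {P} {P})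
                               (Equivalence.from (isRootedIsoᵇ-reflects {P} {P}) (IsRootedIso-id {P}))

  iso-hits-once : ∀ {G H : Graph n} {f} → IsIso G H f → ∀ s → count (λ r → f r ==ᶠ s) (allFin n) ≡ 1
  iso-hits-once {G} {H} {f} f-iso s =
    trans (count-∘-permutation (Iso⇒Permutation {G} {H} (f , f-iso)) (_==ᶠ s)) (occurs-once (allFin-enumerates n) s)

  ∑-rootedIsoCount : ∀ (G H : Graph n) s → ∑[ r ∈ allFin n ] rootedIsoCount (G , r) (H , s) ≡ isoCount G H
  ∑-rootedIsoCount G H s = begin
    ∑[ r ∈ allFin n ] rootedIsoCount (G , r) (H , s)
      ≡⟨ ∑-cong (allFin n) (λ r → count≡∑ _ allMaps) ⟩
    ∑[ r ∈ allFin n ] ∑[ f ∈ allMaps ] [ isRootedIsoᵇ (G , r) (H , s) f ]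
      ≡⟨ ∑-cong (allFin n) (λ r → ∑-cong allMaps (λ f → split (f r ==ᶠ s))) ⟩
    ∑[ r ∈ allFin n ] ∑[ f ∈ allMaps ] ([ isIsoᵇ G H f ] ℕ.* [ f r ==ᶠ s ])
      ≡⟨ ∑-comm (allFin n) allMaps _ ⟩
    ∑[ f ∈ allMaps ] ∑[ r ∈ allFin n ] ([ isIsoᵇ G H f ] ℕ.* [ f r ==ᶠ s ])
      ≡⟨ ∑-cong allMaps (λ f → *-distribˡ-∑ [ isIsoᵇ G H f ] (allFin n) (λ r → [ f r ==ᶠ s ])) ⟨
    ∑[ f ∈ allMaps ] ([ isIsoᵇ G H f ] ℕ.* ∑[ r ∈ allFin n ] [ f r ==ᶠ s ])
      ≡⟨ ∑-cong allMaps hits-once ⟩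
    ∑[ f ∈ allMaps ] [ isIsoᵇ G H f ]
      ≡⟨ count≡∑ _ allMaps ⟨
    isoCount G H ∎
    where
    open ≡-Reasoning
    split : ∀ {f} c → [ isBijectionᵇ f ∧ sendsᵇ G H f ∧ c ] ≡ [ isIsoᵇ G H f ] ℕ.* [ c ]
    split {f} c = trans (cong [_] (sym (∧-assoc (isBijectionᵇ f) _ c))) ([∧] (isIsoᵇ G H f) c)
    hits-once : ∀ f → [ isIsoᵇ G H f ] ℕ.* ∑[ r ∈ allFin n ] [ f r ==ᶠ s ] ≡ [ isIsoᵇ G H f ]
    hits-once f with isIsoᵇ G H f in f-iso
    ... | false = refl
    ... | true  = cong (ℕ._+ 0) (trans (sym (count≡∑ _ (allFin n))) (iso-hits-once {G} {H} {f} f-iso′ s))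
      where f-iso′ = Equivalence.to (isIsoᵇ-reflects {G} {H}) (Equivalence.from T-≡ f-iso)

  -- Invariance of W

  colorings : List (Coloring n)
  colorings = allFunsTo (true ∷ false ∷ []) n

  evenWhiteCount-cong : ∀ (G : Graph n) {c c′ : Coloring n} → c ≗ c′ → evenWhiteCount G c ≡ evenWhiteCount G c′
  evenWhiteCount-cong G c≗c′ = count-cong (allFin n) λ v →
    cong₂ (λ b k → not b ∧ evenᵇ k) (c≗c′ v) (count-cong (allFin n) λ u → cong (G v u ∧_) (c≗c′ u))

  module _ {G H : Graph n} (ψ : Iso G H) where
    private
      ψ→ = proj₁ ψ
      π  = Iso⇒Permutation {G} {H} ψ

    blackNeighbours-∘ : ∀ c v → blackNeighbours G (c ∘ ψ→) v ≡ blackNeighbours H c (ψ→ v)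
    blackNeighbours-∘ c v =
      trans (count-cong (allFin n) (λ u → cong (_∧ c (ψ→ u)) (sym (proj₂ (proj₂ (proj₂ (proj₂ ψ))) v u))))
            (count-∘-permutation π (λ u → H (ψ→ v) u ∧ c u))

    evenWhiteCount-∘ : ∀ c → evenWhiteCount G (c ∘ ψ→) ≡ evenWhiteCount H c
    evenWhiteCount-∘ c =
      trans (count-cong (allFin n) (λ v → cong (λ k → not (c (ψ→ v)) ∧ evenᵇ k) (blackNeighbours-∘ c v)))
            (count-∘-permutation π (isEvenWhite H c))

    Wcoeff-cong : ∀ k → Wcoeff G k ≡ Wcoeff H k
    Wcoeff-cong k = begin
      count (λ c → does (evenWhiteCount G c ℕ.≟ k)) colorings
        ≡⟨ count-∘-inverse (Pointwise.decSetoid Bool-decSetoid n)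
                           (allFunsTo-enumerates Bool-decSetoid booleans-enumerate n)
                           resp (precompose (≡.setoid Bool) π) ⟨
      count (λ c → does (evenWhiteCount G (c ∘ ψ→) ℕ.≟ k)) colorings
        ≡⟨ count-cong colorings (λ c → cong (λ m → does (m ℕ.≟ k)) (evenWhiteCount-∘ c)) ⟩
      count (λ c → does (evenWhiteCount H c ℕ.≟ k)) colorings ∎
      where
      open ≡-Reasoning
      resp : (T ∘ (λ c → does (evenWhiteCount G c ℕ.≟ k))) Respects _≗_
      resp c≗c′ = subst (λ m → T (does (m ℕ.≟ k))) (evenWhiteCount-cong G c≗c′)

fromℕ≡mkℚ : ∀ m → fromℕ m ≡ mkℚ (ℤ.+ m) 0 (Coprime.sym (Coprime.1-coprimeTo m))
fromℕ≡mkℚ m = ℚP.normalize-coprime (Coprime.sym (Coprime.1-coprimeTo m))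

fromℕ-+ : ∀ a b → fromℕ (a ℕ.+ b) ≡ fromℕ a ℚ.+ fromℕ b
fromℕ-+ a b = trans (ℚP./-cong numerators refl) (sym (cong₂ ℚ._+_ (fromℕ≡mkℚ a) (fromℕ≡mkℚ b)))
  where
  numerators : ℤ.+ (a ℕ.+ b) ≡ ℤ.+ a ℤ.* ℤ.+ 1 ℤ.+ ℤ.+ b ℤ.* ℤ.+ 1
  numerators = trans (ℤP.pos-+ a b) (sym (cong₂ ℤ._+_ (ℤP.*-identityʳ (ℤ.+ a)) (ℤP.*-identityʳ (ℤ.+ b))))

fromℕ-∑ : ∀ {X : Set} (xs : List X) (f : X → ℕ) → fromℕ (∑ xs f) ≡ ℚ∑.∑ xs (fromℕ ∘ f)
fromℕ-∑ []       f = refl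
fromℕ-∑ (x ∷ xs) f = trans (fromℕ-+ (f x) (∑ xs f)) (cong (fromℕ (f x) ℚ.+_) (fromℕ-∑ xs f))

fromℕ*inv : ∀ a .{{_ : NonZero a}} → fromℕ a ℚ.* inv a ≡ 1ℚ
fromℕ*inv (suc m) =
  trans (cong₂ ℚ._*_ (fromℕ≡mkℚ (suc m)) (ℚP.normalize-coprime (Coprime.1-coprimeTo (suc m))))
        (ℚP.*-inverseʳ (mkℚ (ℤ.+ suc m) 0 (Coprime.sym (Coprime.1-coprimeTo (suc m)))))

∑-const : ∀ {X : Set} (xs : List X) c → ℚ∑.∑ xs (λ _ → c) ≡ fromℕ (length xs) ℚ.* c
∑-const []       c = sym (ℚP.*-zeroˡ c)
∑-const (x ∷ xs) c = begin
  c ℚ.+ ℚ∑.∑ xs (λ _ → c)              ≡⟨ cong₂ ℚ._+_ (sym (ℚP.*-identityˡ c)) (∑-const xs c) ⟩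
  1ℚ ℚ.* c ℚ.+ fromℕ (length xs) ℚ.* c ≡⟨ ℚP.*-distribʳ-+ c 1ℚ (fromℕ (length xs)) ⟨
  (1ℚ ℚ.+ fromℕ (length xs)) ℚ.* c     ≡⟨ cong (ℚ._* c) (fromℕ-+ 1 (length xs)) ⟨
  fromℕ (suc (length xs)) ℚ.* c        ∎
  where open ≡-Reasoning

module _ (a : ℕ) .{{_ : NonZero a}} where
  open import Algebra.Solver.CommutativeMonoid ℚP.*-1-commutativeMonoid using (solve; _⊕_; _⊜_)

  private
    cancel : ∀ {q} x → q ≡ (fromℕ a ℚ.* inv a) ℚ.* x → q ≡ x
    cancel x q≡ = trans q≡ (trans (cong (ℚ._* x) (fromℕ*inv a)) (ℚP.*-identityˡ x))

  a*[x*[a⁻¹*y]]≡x*y : ∀ x y → fromℕ a ℚ.* (x ℚ.* (inv a ℚ.* y)) ≡ x ℚ.* y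
  a*[x*[a⁻¹*y]]≡x*y x y =
    cancel (x ℚ.* y)
      (solve 4 (λ a i x y → a ⊕ (x ⊕ (i ⊕ y)) ⊜ (a ⊕ i) ⊕ (x ⊕ y)) refl (fromℕ a) (inv a) x y)

  a*[x*[y*a⁻¹]]≡x*y : ∀ x y → fromℕ a ℚ.* (x ℚ.* (y ℚ.* inv a)) ≡ x ℚ.* y
  a*[x*[y*a⁻¹]]≡x*y x y =
    cancel (x ℚ.* y)
      (solve 4 (λ a i x y → a ⊕ (x ⊕ (y ⊕ i)) ⊜ (a ⊕ i) ⊕ (x ⊕ y)) refl (fromℕ a) (inv a) x y)

  [a*x]*a⁻¹≡x : ∀ x → (fromℕ a ℚ.* x) ℚ.* inv a ≡ x
  [a*x]*a⁻¹≡x x = cancel x (solve 3 (λ a i x → (a ⊕ x) ⊕ i ⊜ (a ⊕ i) ⊕ x) refl (fromℕ a) (inv a) x)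

-- The double count

module _ {n : ℕ} (k : ℕ) {Ls : List (Graph n)} {Rs : List (Graph n × Fin n)}
         (Ls-reps : TreeReps n Ls) (Rs-reps : RootedTreeReps n Rs) where
  open ℚ∑ using (∑-transversal; ∑-zero)
    renaming (∑ to ∑ℚ; ∑-cong to ∑ℚ-cong; ∑-cong-All to ∑ℚ-cong-All; ∑-comm to ∑ℚ-comm;
              *-distribˡ-∑ to *-distribˡ-∑ℚ; *-distribʳ-∑ to *-distribʳ-∑ℚ)

  w : Graph n → ℚ
  w G = fromℕ (Wcoeff G k)

  weight : Graph n → Graph n × Fin n → ℚ
  weight G p = w G ℚ.* (inv (autCount G) ℚ.* inv (rootedAutCount p))

  term : Graph n → Fin n → Graph n × Fin n → ℚ
  term G r p = fromℕ (rootedIsoCount (G , r) p) ℚ.* weight G p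

  term-≡0 : ∀ {G r p} → ¬ RootedIso (G , r) p → term G r p ≡ 0ℚ
  term-≡0 {G} {r} {p} ¬iso =
    trans (cong (λ m → fromℕ m ℚ.* weight G p) (rootedIsoCount-≡0 {P = G , r} {Q = p} ¬iso))
          (ℚP.*-zeroˡ (weight G p))

  ∑-term-over-trees : ∀ {p} → IsTree (proj₁ p) →
                      ∑ℚ Ls (λ G → ∑ℚ (allFin n) (λ r → term G r p)) ≡ w (proj₁ p) ℚ.* inv (rootedAutCount p)
  ∑-term-over-trees {p@(H , s)} H-tree = begin
    ∑ℚ Ls (λ G → ∑ℚ (allFin n) (λ r → term G r p))
      ≡⟨ ∑-transversal (iso-isPartialEquivalence {n}) _ (proj₂ (proj₂ Ls-reps)) H∈Ls vanish ⟩
    ∑ℚ (allFin n) (λ r → term G₀ r p)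
      ≡⟨ *-distribʳ-∑ℚ (weight G₀ p) (allFin n) _ ⟨
    ∑ℚ (allFin n) (λ r → fromℕ (rootedIsoCount (G₀ , r) p)) ℚ.* weight G₀ p
      ≡⟨ cong (ℚ._* weight G₀ p) (fromℕ-∑ (allFin n) _) ⟨
    fromℕ (∑ (allFin n) λ r → rootedIsoCount (G₀ , r) p) ℚ.* weight G₀ p
      ≡⟨ cong (λ m → fromℕ m ℚ.* weight G₀ p) ∑N≡|AutG₀| ⟩
    fromℕ (autCount G₀) ℚ.* weight G₀ p
      ≡⟨ a*[x*[a⁻¹*y]]≡x*y (autCount G₀) {{autCount-nonZero G₀}} (w G₀) (inv (rootedAutCount p)) ⟩
    w G₀ ℚ.* inv (rootedAutCount p)
      ≡⟨ cong (λ m → fromℕ m ℚ.* inv (rootedAutCount p)) (Wcoeff-cong ψ k) ⟨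
    w H ℚ.* inv (rootedAutCount p) ∎
    where
    open ≡-Reasoning
    H∈Ls = proj₁ (proj₂ Ls-reps) H H-tree
    G₀ = lookup Ls (index H∈Ls)
    ψ : Iso H G₀
    ψ = lookup-index H∈Ls
    vanish : ∀ G → ¬ Iso H G → ∑ℚ (allFin n) (λ r → term G r p) ≡ 0ℚ
    vanish G ¬H≅G = ∑-zero (All.universal (λ r → term-≡0 {G} {r} {p} (¬H≅G ∘ H≅G)) (allFin n))
      where
      H≅G : ∀ {r} → RootedIso (G , r) p → Iso H G
      H≅G = iso-sym {G = G} {H} ∘ rootedIso⇒iso {G = G} {H}
    ∑N≡|AutG₀| : ∑ (allFin n) (λ r → rootedIsoCount (G₀ , r) p) ≡ autCount G₀
    ∑N≡|AutG₀| = trans (∑-rootedIsoCount G₀ H s) (isoCount-congʳ {G = G₀} {H} {G₀} ψ)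

  ∑-term-over-rooted-trees : ∀ {G} → IsTree G → ∀ r → ∑ℚ Rs (term G r) ≡ w G ℚ.* inv (autCount G)
  ∑-term-over-rooted-trees {G} G-tree r = begin
    ∑ℚ Rs (term G r)
      ≡⟨ ∑-transversal (rootedIso-isPartialEquivalence {n}) _ (proj₂ (proj₂ Rs-reps)) Gr∈Rs
                       (λ p → term-≡0 {G} {r} {p}) ⟩
    term G r p₀
      ≡⟨ cong (λ m → fromℕ m ℚ.* weight G p₀) (rootedIsoCount-congˡ {P = G , r} {p₀} {p₀} φ) ⟩
    fromℕ (rootedAutCount p₀) ℚ.* weight G p₀
      ≡⟨ a*[x*[y*a⁻¹]]≡x*y (rootedAutCount p₀) {{rootedAutCount-nonZero p₀}} (w G) (inv (autCount G)) ⟩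
    w G ℚ.* inv (autCount G) ∎
    where
    open ≡-Reasoning
    Gr∈Rs = proj₁ (proj₂ Rs-reps) G r G-tree
    p₀ = lookup Rs (index Gr∈Rs)
    φ : RootedIso (G , r) p₀
    φ = lookup-index Gr∈Rs

  rooted≡n*unrooted : ∑ℚ Rs (λ p → w (proj₁ p) ℚ.* inv (rootedAutCount p))
                    ≡ fromℕ n ℚ.* ∑ℚ Ls (λ G → w G ℚ.* inv (autCount G))
  rooted≡n*unrooted = begin
    ∑ℚ Rs (λ p → w (proj₁ p) ℚ.* inv (rootedAutCount p))
      ≡⟨ ∑ℚ-cong-All (All.map (sym ∘ ∑-term-over-trees) (proj₁ Rs-reps)) ⟩
    ∑ℚ Rs (λ p → ∑ℚ Ls (λ G → ∑ℚ (allFin n) (λ r → term G r p)))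
      ≡⟨ ∑ℚ-comm Rs Ls _ ⟩
    ∑ℚ Ls (λ G → ∑ℚ Rs (λ p → ∑ℚ (allFin n) (λ r → term G r p)))
      ≡⟨ ∑ℚ-cong Ls (λ G → ∑ℚ-comm Rs (allFin n) _) ⟩
    ∑ℚ Ls (λ G → ∑ℚ (allFin n) (λ r → ∑ℚ Rs (term G r)))
      ≡⟨ ∑ℚ-cong-All (All.map (∑ℚ-cong (allFin n) ∘ ∑-term-over-rooted-trees) (proj₁ Ls-reps)) ⟩
    ∑ℚ Ls (λ G → ∑ℚ (allFin n) (λ _ → w G ℚ.* inv (autCount G)))
      ≡⟨ ∑ℚ-cong Ls (λ G → ∑-over-roots (w G ℚ.* inv (autCount G))) ⟩
    ∑ℚ Ls (λ G → fromℕ n ℚ.* (w G ℚ.* inv (autCount G)))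
      ≡⟨ *-distribˡ-∑ℚ (fromℕ n) Ls _ ⟨
    fromℕ n ℚ.* ∑ℚ Ls (λ G → w G ℚ.* inv (autCount G)) ∎
    where
    open ≡-Reasoning
    ∑-over-roots : ∀ q → ∑ℚ (allFin n) (λ _ → q) ≡ fromℕ n ℚ.* q
    ∑-over-roots q = trans (∑-const (allFin n) q) (cong (λ m → fromℕ m ℚ.* q) (length-tabulate {n = n} id))

corollary4p9 : (L : (n : ℕ) → List (Graph n)) (R : (n : ℕ) → List (Graph n × Fin n))
    → (∀ n → TreeReps n (L n)) → (∀ n → RootedTreeReps n (R n))
    → ∀ n k → W₀ L n k ≡ integral (divX (𝒯 R)) n k
corollary4p9 L R L-reps R-reps zero    k =
  ℚ∑.∑-zero (All.map (λ G-tree → contradiction (IsTree.nonempty G-tree) λ ()) (proj₁ (L-reps 0)))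
corollary4p9 L R L-reps R-reps (suc m) k =
  sym (trans (cong (ℚ._* inv (suc m)) (rooted≡n*unrooted k (L-reps (suc m)) (R-reps (suc m))))
             ([a*x]*a⁻¹≡x (suc m) (W₀ L (suc m) k)))
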